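{- Let $G$ be a finite connected even graph, let $\mathcal{C}$ be a cycle decomposition of $G$, and let $CI(G)$ be the cycle intersection graph of $G$ with respect to $\mathcal{C}$. If $CI(G)$ is a tree, then $G$ has a unique cycle decomposition.
   Context: An even graph is a graph in which every vertex has even degree (multiple edges are allowed). A cycle decomposition of $G$ is a collection of cycles of $G$ whose edge sets partition $E(G)$. The cycle intersection graph $CI(G)$ with respect to a cycle decomposition $\mathcal{C}$ is the (multi)graph whose vertex set is $\mathcal{C}$ and which has, for each pair of distinct cycles $C,C'\in\mathcal{C}$ and each vertex $v\in V(C)\cap V(C')$, one edge joining $C$ and $C'$ (corresponding to $v$). -}

module Defs where

open import Data.Nat as ℕ using (ℕ; zero; suc; _+_; _*_)
open import Data.Nat.Divisibility using (_∣_)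
open import Data.Fin using (Fin; zero; suc; inject₁; fromℕ; _<?_; _≟_)
open import Data.Fin.Subset using (Subset; _∈_)
open import Data.Fin.Subset.Properties using (_∈?_)
open import Data.List using (List; allFin; map)
open import Data.Nat.ListAction using (sum)
open import Data.Bool.ListAction using (any)
open import Data.Bool using (Bool; true; false; _∧_; _∨_; T)
open import Data.Product using (Σ; ∃; _×_; _,_; proj₁; proj₂)
open import Data.Sum using (_⊎_)
open import Relation.Nullary using (¬_)
open import Relation.Nullary.Decidable using (⌊_⌋)
open import Relation.Binary.PropositionalEquality using (_≡_)
open import Function.Definitions using (Injective)

-- General (multi)graphs: a vertex type, an edge type, and for each
-- edge its (unordered) pair of endpoints.  Parallel edges are allowed.

record Graph : Set₁ where
  field
    V    : Set
    E    : Set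
    ends : E → V × V

open Graph public

Joins : (G : Graph) → E G → V G → V G → Set
Joins G e a b = (ends G e ≡ (a , b)) ⊎ (ends G e ≡ (b , a))

data Walk (G : Graph) : V G → V G → Set where
  [] : ∀ {u} → Walk G u u
  step : ∀ {u w v} (e : E G) → Joins G e u w → Walk G w v → Walk G u v

Connected : Graph → Set
Connected G = ∀ (u v : V G) → Walk G u v

-- Length ≥ 2 (a 2-cycle is a pair of parallel edges).
record Cycle (G : Graph) : Set where
  field
    l      : ℕ
    verts  : Fin (suc (suc l)) → V G
    edges  : Fin (suc (suc l)) → E G
    verts-inj : Injective _≡_ _≡_ verts
    edges-inj : Injective _≡_ _≡_ edges
    consec : ∀ (i : Fin (suc l)) →
               Joins G (edges (inject₁ i)) (verts (inject₁ i)) (verts (suc i))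
    close  : Joins G (edges (fromℕ (suc l))) (verts (fromℕ (suc l))) (verts zero)

open Cycle public

IsTree : Graph → Set
IsTree G = Connected G × ¬ Cycle G

record FinGraph : Set where
  field
    n m  : ℕ
    endp : Fin m → Fin n × Fin n
    loopless : ∀ e → ¬ (proj₁ (endp e) ≡ proj₂ (endp e))

open FinGraph public

toGraph : FinGraph → Graph
toGraph G = record { V = Fin (n G) ; E = Fin (m G) ; ends = endp G }

incident : (G : FinGraph) → Fin (n G) → Fin (m G) → Bool
incident G v e = ⌊ v ≟ proj₁ (endp G e) ⌋ ∨ ⌊ v ≟ proj₂ (endp G e) ⌋

-- degree (loopless, so each incident edge contributes 1)
degree : (G : FinGraph) → Fin (n G) → ℕ
degree G v = sum (map (λ e → if-inc (incident G v e)) (allFin (m G)))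
  where
    if-inc : Bool → ℕ
    if-inc true  = 1
    if-inc false = 0

Even : FinGraph → Set
Even G = ∀ v → 2 ∣ degree G v

IsCycleEdgeSet : (G : FinGraph) → Subset (m G) → Set
IsCycleEdgeSet G S =
  Σ (Cycle (toGraph G)) λ c →
    ∀ e → (e ∈ S → ∃ λ i → edges c i ≡ e) × ((∃ λ i → edges c i ≡ e) → e ∈ S)

record CycleDecomposition (G : FinGraph) : Set where
  field
    k        : ℕ
    cyc      : Fin k → Subset (m G)
    isCycle  : ∀ i → IsCycleEdgeSet G (cyc i)
    covers   : ∀ e → ∃ λ i → e ∈ cyc i
    disjoint : ∀ e i j → e ∈ cyc i → e ∈ cyc j → i ≡ j

open CycleDecomposition public

onCycle : (G : FinGraph) → Subset (m G) → Fin (n G) → Bool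
onCycle G S v = any (λ e → ⌊ e ∈? S ⌋ ∧ incident G v e) (allFin (m G))

-- Cycle intersection graph: vertices are the cycles of 𝒞; one edge between
-- Cᵢ and Cⱼ (i < j) for each vertex v ∈ V(Cᵢ) ∩ V(Cⱼ).
CI : (G : FinGraph) → CycleDecomposition G → Graph
CI G D = record
  { V = Fin (k D)
  ; E = Σ (Fin (k D) × Fin (k D) × Fin (n G)) λ where
          (i , j , v) → T (⌊ i <? j ⌋ ∧ onCycle G (cyc D i) v ∧ onCycle G (cyc D j) v)
  ; ends = λ where ((i , j , v) , _) → (i , j)
  }

SameDecomposition : (G : FinGraph) → CycleDecomposition G → CycleDecomposition G → Set
SameDecomposition G D D' =
  (∀ i → ∃ λ j → cyc D' j ≡ cyc D i) × (∀ j → ∃ λ i → cyc D i ≡ cyc D' j)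

HasUniqueCycleDecomposition : FinGraph → Set
HasUniqueCycleDecomposition G =
  Σ (CycleDecomposition G) λ D → ∀ (D' : CycleDecomposition G) → SameDecomposition G D D'

-- If a cycle c of G used edges of two different parts of 𝒞, then walking around c and
-- recording the part of the current edge would give a closed walk in CI(G) that moves at
-- least once and whose moves pass through pairwise distinct vertices of c, hence use
-- pairwise distinct edges of CI(G); such a walk contains a cycle.  So when CI(G) is a
-- tree every cycle of G lies inside a single part of 𝒞, and since no cycle properly
-- contains another, it is that part.  Any other decomposition therefore consists of
-- parts of 𝒞, and as both partition E(G) it consists of all of them.

module Submission where

open import Data.Bool using (T)
open import Data.Bool.Properties using (T-∧; T-∨)
open import Data.Fin as Fin using (Fin; zero; suc; inject₁; fromℕ; toℕ; lower₁)
import Data.Fin.Properties as Fin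
open import Data.Fin.Subset using (_∈_; _⊆_)
open import Data.Fin.Subset.Properties using (⊆-antisym)
open import Data.List.Membership.Propositional using (lose)
open import Data.List.Membership.Propositional.Properties using (∈-allFin)
open import Data.List.Relation.Unary.Any.Properties using (any⁺)
open import Data.Nat as ℕ using (ℕ; zero; suc; _+_; _≤_; _<_; s≤s; z<s)
open import Data.Nat.Induction using (<-rec)
import Data.Nat.Properties as ℕ
open import Data.Product using (∃; _×_; _,_; proj₁; proj₂)
open import Data.Sum using (_⊎_; inj₁; inj₂)
open import Function using (_∘_; Equivalence)
open import Function.Definitions using (Injective)
open import Relation.Binary.Definitions using (DecidableEquality; tri<; tri≈; tri>)
open import Relation.Binary.PropositionalEquality
open import Relation.Nullary using (¬_; yes; no; contradiction)
open import Relation.Nullary.Decidable using (fromWitness)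
import Relation.Unary as U

open import Defs

private variable d : ℕ

next : Fin (suc d) → Fin (suc d)
next {d} t with d ℕ.≟ toℕ t
... | yes _   = zero
... | no d≢t = suc (lower₁ t d≢t)

prev : Fin (suc d) → Fin (suc d)
prev zero    = fromℕ _
prev (suc i) = inject₁ i

next-inject₁ : (i : Fin d) → next (inject₁ i) ≡ suc i
next-inject₁ {d} i with d ℕ.≟ toℕ (inject₁ i)
... | yes d≡i = contradiction d≡i (Fin.toℕ-inject₁-≢ i)
... | no d≢i  = cong suc (Fin.lower₁-inject₁′ i d≢i)

next-fromℕ : ∀ d → next (fromℕ d) ≡ zero
next-fromℕ d with d ℕ.≟ toℕ (fromℕ d)
... | yes _   = refl
... | no d≢d = contradiction (sym (Fin.toℕ-fromℕ d)) d≢d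

toℕ-next : (t : Fin (suc d)) → toℕ t < d → toℕ (next t) ≡ suc (toℕ t)
toℕ-next {d} t t<d with d ℕ.≟ toℕ t
... | yes d≡t = contradiction (sym d≡t) (ℕ.<⇒≢ t<d)
... | no d≢t  = cong suc (Fin.toℕ-lower₁ t d≢t)

next-injective : {s t : Fin (suc d)} → next s ≡ next t → s ≡ t
next-injective {d} {s} {t} eq with d ℕ.≟ toℕ s | d ℕ.≟ toℕ t
... | yes d≡s | yes d≡t = Fin.toℕ-injective (trans (sym d≡s) d≡t)
... | no d≢s  | no d≢t  = Fin.lower₁-injective (Fin.suc-injective eq)
next-injective eq | yes _ | no _ with () ← eq
next-injective eq | no _  | yes _ with () ← eq

next≢ : (t : Fin (suc (suc d))) → next t ≢ t
next≢ {d} t eq with suc d ℕ.≟ toℕ t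
... | yes d≡t = contradiction (trans d≡t (cong toℕ (sym eq))) λ ()
... | no d≢t  = ℕ.1+n≢n (trans (sym (cong suc (Fin.toℕ-lower₁ t d≢t))) (cong toℕ eq))

next-prev : (t : Fin (suc d)) → next (prev t) ≡ t
next-prev zero    = next-fromℕ _
next-prev (suc i) = next-inject₁ i

pos : ℕ → Fin (suc d)
pos zero    = zero
pos (suc s) = next (pos s)

toℕ-pos : ∀ {s} → s ≤ d → toℕ (pos {d} s) ≡ s
toℕ-pos {s = zero}  _   = refl
toℕ-pos {s = suc s} s<d = begin
  toℕ (next (pos s))  ≡⟨ toℕ-next (pos s) (subst (_< _) (sym (toℕ-pos (ℕ.<⇒≤ s<d))) s<d) ⟩
  suc (toℕ (pos s))   ≡⟨ cong suc (toℕ-pos (ℕ.<⇒≤ s<d)) ⟩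
  suc s               ∎
  where open ≡-Reasoning

pos-toℕ : (t : Fin (suc d)) → pos (toℕ t) ≡ t
pos-toℕ t = Fin.toℕ-injective (toℕ-pos (Fin.toℕ≤pred[n] t))

pos-period : ∀ d → pos {d} (suc d) ≡ zero
pos-period d = trans (cong next (Fin.toℕ-injective (trans (toℕ-pos ℕ.≤-refl) (sym (Fin.toℕ-fromℕ d)))))
                     (next-fromℕ d)

inject₁-or-fromℕ : (t : Fin (suc d)) → (∃ λ i → t ≡ inject₁ i) ⊎ t ≡ fromℕ d
inject₁-or-fromℕ {d} t with d ℕ.≟ toℕ t
... | yes d≡t = inj₂ (Fin.toℕ-injective (trans (sym d≡t) (sym (Fin.toℕ-fromℕ d))))
... | no d≢t  = inj₁ (lower₁ t d≢t , sym (Fin.inject₁-lower₁ t d≢t))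

module _ {H : Graph} where

  Endpoint : E H → V H → Set
  Endpoint e x = proj₁ (ends H e) ≡ x ⊎ proj₂ (ends H e) ≡ x

  joins⇒endpointˡ : ∀ {e a b} → Joins H e a b → Endpoint e a
  joins⇒endpointˡ (inj₁ eq) = inj₁ (cong proj₁ eq)
  joins⇒endpointˡ (inj₂ eq) = inj₂ (cong proj₂ eq)

  joins⇒endpointʳ : ∀ {e a b} → Joins H e a b → Endpoint e b
  joins⇒endpointʳ (inj₁ eq) = inj₂ (cong proj₂ eq)
  joins⇒endpointʳ (inj₂ eq) = inj₁ (cong proj₁ eq)

  endpoint-of-joins : ∀ {e a b x} → Joins H e a b → Endpoint e x → x ≡ a ⊎ x ≡ b
  endpoint-of-joins (inj₁ eq) (inj₁ e₁≡x) = inj₁ (trans (sym e₁≡x) (cong proj₁ eq))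
  endpoint-of-joins (inj₁ eq) (inj₂ e₂≡x) = inj₂ (trans (sym e₂≡x) (cong proj₂ eq))
  endpoint-of-joins (inj₂ eq) (inj₁ e₁≡x) = inj₂ (trans (sym e₁≡x) (cong proj₁ eq))
  endpoint-of-joins (inj₂ eq) (inj₂ e₂≡x) = inj₁ (trans (sym e₂≡x) (cong proj₂ eq))

  module _ (c : Cycle H) where

    joins-next : ∀ t → Joins H (edges c t) (verts c t) (verts c (next t))
    joins-next t with inject₁-or-fromℕ t
    ... | inj₁ (i , refl) rewrite next-inject₁ i     = consec c i
    ... | inj₂ refl       rewrite next-fromℕ (suc (l c)) = close c

    endpoint-position : ∀ {q r} → Endpoint (edges c q) (verts c r) → r ≡ q ⊎ r ≡ next q
    endpoint-position {q} x with endpoint-of-joins (joins-next q) x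
    ... | inj₁ eq = inj₁ (verts-inj c eq)
    ... | inj₂ eq = inj₂ (verts-inj c eq)

    other-edge : ∀ {t x} → Endpoint (edges c t) x → ∃ λ t′ → t′ ≢ t × Endpoint (edges c t′) x
    other-edge {t} x with endpoint-of-joins (joins-next t) x
    ... | inj₁ refl = prev t , (λ t≡ → next≢ t (trans (cong next (sym t≡)) (next-prev t)))
                    , subst (Endpoint (edges c (prev t)) ∘ verts c) (next-prev t)
                            (joins⇒endpointʳ (joins-next (prev t)))
    ... | inj₂ refl = next t , next≢ t , joins⇒endpointˡ (joins-next (next t))

  module _ (C A : Cycle H) (C⊆A : ∀ t → ∃ λ q → edges A q ≡ edges C t) where

    private
      OnC : Fin (suc (suc (l A))) → Set
      OnC q = ∃ λ t → edges C t ≡ edges A q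

      -- The only edges of A at verts A (next q) are q and next q, and C has two edges there.
      other-at-joint : ∀ {q a} → OnC a → Endpoint (edges A a) (verts A (next q)) →
                       ∃ λ a′ → a′ ≢ a × OnC a′ × (a′ ≡ q ⊎ a′ ≡ next q)
      other-at-joint {q} {a} (t , t≡a) x
        with t′ , t′≢t , x′ ← other-edge C (subst (λ e → Endpoint e _) (sym t≡a) x)
        with a′ , a′≡t′ ← C⊆A t′
        = a′ , a′≢a , (t′ , sym a′≡t′)
        , joint (endpoint-position A (subst (λ e → Endpoint e _) (sym a′≡t′) x′))
        where
          a′≢a : a′ ≢ a
          a′≢a a′≡a = t′≢t (edges-inj C (trans (sym a′≡t′) (trans (cong (edges A) a′≡a) (sym t≡a))))
          joint : next q ≡ a′ ⊎ next q ≡ next a′ → a′ ≡ q ⊎ a′ ≡ next q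
          joint (inj₁ eq) = inj₂ (sym eq)
          joint (inj₂ eq) = inj₁ (sym (next-injective eq))

      onC-next : ∀ {q} → OnC q → OnC (next q)
      onC-next {q} on with other-at-joint on (joins⇒endpointʳ (joins-next A q))
      ... | _ , a′≢q , _   , inj₁ a′≡q = contradiction a′≡q a′≢q
      ... | _ , _    , on′ , inj₂ refl = on′

      onC-next⁻¹ : ∀ {q} → OnC (next q) → OnC q
      onC-next⁻¹ {q} on with other-at-joint {q} on (joins⇒endpointˡ (joins-next A (next q)))
      ... | _ , _     , on′ , inj₁ refl = on′
      ... | _ , a′≢q+ , _   , inj₂ a′≡q+ = contradiction a′≡q+ a′≢q+

      onC-zero⇒onC-pos : OnC zero → ∀ s → OnC (pos s)
      onC-zero⇒onC-pos on zero    = on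
      onC-zero⇒onC-pos on (suc s) = onC-next (onC-zero⇒onC-pos on s)

      onC-pos⇒onC-zero : ∀ s → OnC (pos s) → OnC zero
      onC-pos⇒onC-zero zero    on = on
      onC-pos⇒onC-zero (suc s) on = onC-pos⇒onC-zero s (onC-next⁻¹ on)

    cycle-edges-⊆⇒⊇ : ∀ q → ∃ λ t → edges C t ≡ edges A q
    cycle-edges-⊆⇒⊇ q = subst OnC (pos-toℕ q) (onC-zero⇒onC-pos onC-zero (toℕ q))
      where
        onC-zero : OnC zero
        onC-zero with q₁ , q₁≡ ← C⊆A zero =
          onC-pos⇒onC-zero (toℕ q₁) (subst OnC (sym (pos-toℕ q₁)) (zero , sym q₁≡))

module _ {P : ℕ → Set} (P? : U.Decidable P) where

  Least : ℕ → Set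
  Least n = ∃ λ j → P j × j ≤ n × (∀ {i} → i < j → ¬ P i)

  least : ∀ {n} → P n → Least n
  least {n} = <-rec (λ n → P n → Least n) smaller n
    where
      smaller : ∀ n → (∀ {m} → m < n → P m → Least m) → P n → Least n
      smaller n rec pn with ℕ.anyUpTo? P? n
      ... | no none = n , pn , ℕ.≤-refl , λ i<n pi → none (_ , i<n , pi)
      ... | yes (m , m<n , pm) with j , pj , j≤m , minimal ← rec m<n pm =
        j , pj , ℕ.≤-trans j≤m (ℕ.<⇒≤ m<n) , minimal

-- skip p enumerates ℕ ∖ {p} in increasing order (the ℕ-analogue of Fin.punchIn).
skip : ℕ → ℕ → ℕ
skip zero    s       = suc s
skip (suc p) zero    = zero
skip (suc p) (suc s) = suc (skip p s)

skip-injective : ∀ p {s s′} → skip p s ≡ skip p s′ → s ≡ s′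
skip-injective zero    refl = refl
skip-injective (suc p) {zero}  {zero}   _  = refl
skip-injective (suc p) {suc s} {suc s′} eq = cong suc (skip-injective p (ℕ.suc-injective eq))

skip-< : ∀ p {s N} → s < N → skip p s < suc N
skip-< zero    s<N           = s≤s s<N
skip-< (suc p) {zero}  z<s  = z<s
skip-< (suc p) {suc s} (s≤s s<N) = s≤s (skip-< p s<N)

skip-≥ : ∀ {p s} → p ≤ s → skip p s ≡ suc s
skip-≥ {zero}  _         = refl
skip-≥ {suc p} (s≤s p≤s) = cong suc (skip-≥ p≤s)

skip-onto : ∀ {p q N} → p ≤ N → q < suc N → q ≢ p → ∃ λ s → s < N × skip p s ≡ q
skip-onto {zero}  {zero}  _ _ q≢p = contradiction refl q≢p
skip-onto {zero}  {suc q} _ (s≤s q<N) _ = q , q<N , refl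
skip-onto {suc p} {zero}  (s≤s _) _ _ = zero , z<s , refl
skip-onto {suc p} {suc q} (s≤s p≤N) (s≤s q<N) q≢p
  with s , s<N , refl ← skip-onto p≤N q<N (q≢p ∘ cong suc) = suc s , s≤s s<N , refl

module _ {A : Set} where

  skip-zero : ∀ (f : ℕ → A) {p} → f p ≡ f (suc p) → f (skip p 0) ≡ f 0
  skip-zero f {zero}  pause = sym pause
  skip-zero f {suc p} _    = refl

  skip-suc : ∀ (f : ℕ → A) {p} → f p ≡ f (suc p) → ∀ s → f (skip p (suc s)) ≡ f (suc (skip p s))
  skip-suc f {zero}        _     _       = refl
  skip-suc f {suc zero}    pause zero    = sym pause
  skip-suc f {suc (suc p)} _     zero    = refl
  skip-suc f {suc p}       pause (suc s) = skip-suc (f ∘ suc) pause s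

module _ {H : Graph} (_≟ᵥ_ : DecidableEquality (V H)) {X : Set} (label : E H → X) where

  -- A closed walk that may pause: a moving step s uses an edge labelled tag s, and
  -- distinct steps carry distinct tags, so no edge is used twice.
  record TaggedClosedWalk (N : ℕ) : Set where
    field
      vertex : ℕ → V H
      tag    : ℕ → X
      closed : vertex N ≡ vertex 0
      move   : ∀ {s} → s < N → vertex s ≢ vertex (suc s) →
               ∃ λ e → Joins H e (vertex s) (vertex (suc s)) × label e ≡ tag s
      tag-injective : ∀ {s s′} → s < N → s′ < N → tag s ≡ tag s′ → s ≡ s′

  open TaggedClosedWalk

  Moves : ∀ {N} → TaggedClosedWalk N → ℕ → Set
  Moves W s = vertex W s ≢ vertex W (suc s)

  closedTrail⇒Cycle : ∀ ℓ (v : ℕ → V H) (e : Fin (suc (suc ℓ)) → E H) →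
                      (∀ t → Joins H (e t) (v (toℕ t)) (v (suc (toℕ t)))) →
                      v (suc (suc ℓ)) ≡ v 0 →
                      Injective _≡_ _≡_ (v ∘ toℕ) → Injective _≡_ _≡_ e → Cycle H
  closedTrail⇒Cycle ℓ v e joins closed v-inj e-inj = record
    { l = ℓ ; verts = v ∘ toℕ ; edges = e ; verts-inj = v-inj ; edges-inj = e-inj
    ; consec = λ i → subst (λ r → Joins H (e (inject₁ i)) (v (toℕ (inject₁ i))) (v (suc r)))
                           (Fin.toℕ-inject₁ i) (joins (inject₁ i))
    ; close  = subst (Joins H (e last) (v (toℕ last)))
                     (trans (cong (v ∘ suc) (Fin.toℕ-fromℕ (suc ℓ))) closed) (joins last)
    }
    where
      last : Fin (suc (suc ℓ))
      last = fromℕ (suc ℓ)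

  closedSegment⇒Cycle : ∀ {N} (W : TaggedClosedWalk N) → (∀ {s} → s < N → Moves W s) →
                        ∀ i ℓ → i + suc (suc ℓ) ≤ N → vertex W (i + suc (suc ℓ)) ≡ vertex W i →
                        (∀ {a b} → a < i + suc (suc ℓ) → b < i + suc (suc ℓ) →
                                   vertex W a ≡ vertex W b → a ≡ b) →
                        Cycle H
  closedSegment⇒Cycle {N} W moves i ℓ end≤N closed′ distinct =
    closedTrail⇒Cycle ℓ (λ s → vertex W (i + s)) edge joins
      (trans closed′ (cong (vertex W) (sym (ℕ.+-identityʳ i))))
      (λ eq → offset-injective (distinct (idx<end _) (idx<end _) eq))
      (λ eq → offset-injective (tag-injective W (idx<N _) (idx<N _) (tag≡ eq)))
    where
      idx<end : (t : Fin (suc (suc ℓ))) → i + toℕ t < i + suc (suc ℓ)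
      idx<end t = ℕ.+-monoʳ-< i (Fin.toℕ<n t)

      idx<N : (t : Fin (suc (suc ℓ))) → i + toℕ t < N
      idx<N t = ℕ.<-≤-trans (idx<end t) end≤N

      moveAt : (t : Fin (suc (suc ℓ))) →
               ∃ λ e → Joins H e (vertex W (i + toℕ t)) (vertex W (suc (i + toℕ t)))
                     × label e ≡ tag W (i + toℕ t)
      moveAt t = move W (idx<N t) (moves (idx<N t))

      edge : Fin (suc (suc ℓ)) → E H
      edge t = proj₁ (moveAt t)

      joins : ∀ t → Joins H (edge t) (vertex W (i + toℕ t)) (vertex W (i + suc (toℕ t)))
      joins t = subst (Joins H (edge t) (vertex W (i + toℕ t)) ∘ vertex W) (sym (ℕ.+-suc i (toℕ t)))
                      (proj₁ (proj₂ (moveAt t)))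

      tag≡ : ∀ {a b} → edge a ≡ edge b → tag W (i + toℕ a) ≡ tag W (i + toℕ b)
      tag≡ {a} {b} eq =
        trans (sym (proj₂ (proj₂ (moveAt a)))) (trans (cong label eq) (proj₂ (proj₂ (moveAt b))))

      offset-injective : ∀ {a b : Fin (suc (suc ℓ))} → i + toℕ a ≡ i + toℕ b → a ≡ b
      offset-injective eq = Fin.toℕ-injective (ℕ.+-cancelˡ-≡ i _ _ eq)

  -- The first repeated vertex closes a cycle, of length ≥ 2 because every step moves.
  strictClosedWalk⇒Cycle : ∀ {N} (W : TaggedClosedWalk N) → 0 < N →
                           (∀ {s} → s < N → Moves W s) → Cycle H
  strictClosedWalk⇒Cycle {N} W 0<N moves = fromFirstRepeat (least repeats? (0 , 0<N , sym (closed W)))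
    where
      Repeats : ℕ → Set
      Repeats j = ∃ λ i → i < j × vertex W i ≡ vertex W j

      repeats? : U.Decidable Repeats
      repeats? j = ℕ.anyUpTo? (λ i → vertex W i ≟ᵥ vertex W j) j

      fromFirstRepeat : Least repeats? N → Cycle H
      fromFirstRepeat (j , (i , i<j , vi≡vj) , j≤N , first) =
        closedSegment⇒Cycle W moves i ℓ (subst (_≤ N) (sym i+L≡j) j≤N)
          (trans (cong (vertex W) i+L≡j) (sym vi≡vj))
          (λ a< b< → distinct (subst (_ <_) i+L≡j a<) (subst (_ <_) i+L≡j b<))
        where
          1+i<j : suc i < j
          1+i<j with ℕ.m≤n⇒m<n∨m≡n i<j
          ... | inj₁ 1+i<j = 1+i<j
          ... | inj₂ 1+i≡j = contradiction (subst (λ r → vertex W i ≡ vertex W r) (sym 1+i≡j) vi≡vj)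
                                           (moves (ℕ.<-≤-trans i<j j≤N))

          ℓ : ℕ
          ℓ = proj₁ (ℕ.m≤n⇒∃[o]m+o≡n 1+i<j)

          i+L≡j : i + suc (suc ℓ) ≡ j
          i+L≡j = begin
            i + suc (suc ℓ)  ≡⟨ ℕ.+-suc i (suc ℓ) ⟩
            suc (i + suc ℓ)  ≡⟨ cong suc (ℕ.+-suc i ℓ) ⟩
            suc (suc i) + ℓ  ≡⟨ proj₂ (ℕ.m≤n⇒∃[o]m+o≡n 1+i<j) ⟩
            j                ∎
            where open ≡-Reasoning

          distinct : ∀ {a b} → a < j → b < j → vertex W a ≡ vertex W b → a ≡ b
          distinct {a} {b} a<j b<j eq with ℕ.<-cmp a b
          ... | tri< a<b _ _ = contradiction (a , a<b , eq) (first b<j)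
          ... | tri≈ _ a≡b _ = a≡b
          ... | tri> _ _ b<a = contradiction (b , b<a , sym eq) (first a<j)

  dropPause : ∀ {N} (W : TaggedClosedWalk (suc N)) {p} → p ≤ N → vertex W p ≡ vertex W (suc p) →
              TaggedClosedWalk N
  dropPause {N} W {p} p≤N pause = record
    { vertex = vertex W ∘ skip p
    ; tag    = tag W ∘ skip p
    ; closed = trans (cong (vertex W) (skip-≥ p≤N)) (trans (closed W) (sym (skip-zero (vertex W) pause)))
    ; move   = λ {s} s<N moves →
        let e , joins , label≡ = move W (skip-< p s<N) (λ eq → moves (trans eq (sym (next≡ s))))
        in  e , subst (Joins H e _) (sym (next≡ s)) joins , label≡
    ; tag-injective = λ s<N s′<N eq → skip-injective p (tag-injective W (skip-< p s<N) (skip-< p s′<N) eq)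
    }
    where
      next≡ : ∀ s → vertex W (skip p (suc s)) ≡ vertex W (suc (skip p s))
      next≡ = skip-suc (vertex W) pause

  dropPause-moves : ∀ {N} (W : TaggedClosedWalk (suc N)) {p} (p≤N : p ≤ N)
                    (pause : vertex W p ≡ vertex W (suc p)) →
                    ∀ {q} → q < suc N → Moves W q → ∃ λ s → s < N × Moves (dropPause W p≤N pause) s
  dropPause-moves W p≤N pause {q} q<N moves
    with s , s<N , refl ← skip-onto p≤N q<N (λ { refl → moves pause })
    = s , s<N , λ eq → moves (trans eq (skip-suc (vertex W) pause s))

  closedWalk⇒Cycle : ∀ {N} (W : TaggedClosedWalk N) → (∃ λ q → q < N × Moves W q) → Cycle H
  closedWalk⇒Cycle {zero}  W (_ , () , _)
  closedWalk⇒Cycle {suc N} W (q , q<N , moves)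
    with ℕ.anyUpTo? (λ s → vertex W s ≟ᵥ vertex W (suc s)) (suc N)
  ... | yes (p , p<N , pause) =
    closedWalk⇒Cycle (dropPause W (ℕ.≤-pred p<N) pause) (dropPause-moves W (ℕ.≤-pred p<N) pause q<N moves)
  ... | no noPause = strictClosedWalk⇒Cycle W z<s (λ s<N pause → noPause (_ , s<N , pause))

  acyclic⇒closedWalk-constant : ¬ Cycle H → ∀ {N} (W : TaggedClosedWalk N) →
                                ∀ {s} → s ≤ N → vertex W s ≡ vertex W 0
  acyclic⇒closedWalk-constant acyclic W {zero}  _   = refl
  acyclic⇒closedWalk-constant acyclic W {suc s} s<N with vertex W s ≟ᵥ vertex W (suc s)
  ... | yes pause = trans (sym pause) (acyclic⇒closedWalk-constant acyclic W (ℕ.<⇒≤ s<N))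
  ... | no moves  = contradiction (closedWalk⇒Cycle W (s , s<N , moves)) acyclic

module _ (G : FinGraph) where

  incident-intro : ∀ {e v} → Endpoint {toGraph G} e v → T (incident G v e)
  incident-intro {v = v} (inj₁ eq) = Equivalence.from T-∨ (inj₁ (fromWitness {a? = v Fin.≟ _} (sym eq)))
  incident-intro {v = v} (inj₂ eq) = Equivalence.from T-∨ (inj₂ (fromWitness {a? = v Fin.≟ _} (sym eq)))

  onCycle-intro : ∀ {S e v} → e ∈ S → Endpoint {toGraph G} e v → T (onCycle G S v)
  onCycle-intro {e = e} e∈S x =
    any⁺ _ (lose (∈-allFin e) (Equivalence.from T-∧ (fromWitness e∈S , incident-intro x)))

  cycleEdgeSet-⊆⇒≡ : ∀ {S S′} → IsCycleEdgeSet G S → IsCycleEdgeSet G S′ → S ⊆ S′ → S ≡ S′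
  cycleEdgeSet-⊆⇒≡ {S} {S′} (C , onC) (A , onA) S⊆S′ = ⊆-antisym S⊆S′ S′⊆S
    where
      C⊆A : ∀ t → ∃ λ q → edges A q ≡ edges C t
      C⊆A t = proj₁ (onA _) (S⊆S′ (proj₂ (onC _) (t , refl)))

      S′⊆S : S′ ⊆ S
      S′⊆S e∈S′ with q , refl ← proj₁ (onA _) e∈S′ = proj₂ (onC _) (cycle-edges-⊆⇒⊇ C A C⊆A q)

  module _ (D : CycleDecomposition G) where

    part : Fin (m G) → Fin (k D)
    part e = proj₁ (covers D e)

    ∈-part : ∀ e → e ∈ cyc D (part e)
    ∈-part e = proj₂ (covers D e)

    sharedVertex : E (CI G D) → Fin (n G)
    sharedVertex ((_ , _ , v) , _) = v

    CI-edge< : ∀ {a b} v → a Fin.< b → T (onCycle G (cyc D a) v) → T (onCycle G (cyc D b) v) → E (CI G D)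
    CI-edge< {a} {b} v a<b v∈a v∈b =
      (a , b , v) , Equivalence.from T-∧ (fromWitness {a? = a Fin.<? b} a<b , Equivalence.from T-∧ (v∈a , v∈b))

    CI-edge : ∀ {a b v} → a ≢ b → T (onCycle G (cyc D a) v) → T (onCycle G (cyc D b) v) →
              ∃ λ e → Joins (CI G D) e a b × sharedVertex e ≡ v
    CI-edge {a} {b} {v} a≢b v∈a v∈b with Fin.<-cmp a b
    ... | tri< a<b _ _ = CI-edge< v a<b v∈a v∈b , inj₁ refl , refl
    ... | tri≈ _ a≡b _ = contradiction a≡b a≢b
    ... | tri> _ _ b<a = CI-edge< v b<a v∈b v∈a , inj₂ refl , refl

    partWalk : (c : Cycle (toGraph G)) → TaggedClosedWalk Fin._≟_ sharedVertex (suc (suc (l c)))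
    partWalk c = record
      { vertex = λ s → part (edges c (pos s))
      ; tag    = λ s → verts c (pos (suc s))
      ; closed = cong (part ∘ edges c) (pos-period (suc (l c)))
      ; move   = λ {s} _ moves → CI-edge moves
          (onCycle-intro (∈-part _) (joins⇒endpointʳ {toGraph G} (joins-next c (pos s))))
          (onCycle-intro (∈-part _) (joins⇒endpointˡ {toGraph G} (joins-next c (next (pos s)))))
      ; tag-injective = λ {s} {s′} s<L s′<L eq → begin
          s                ≡⟨ toℕ-pos (ℕ.≤-pred s<L) ⟨
          toℕ (pos s)      ≡⟨ cong toℕ (next-injective (verts-inj c eq)) ⟩
          toℕ (pos s′)     ≡⟨ toℕ-pos (ℕ.≤-pred s′<L) ⟩
          s′               ∎
      }
      where open ≡-Reasoning

    cycle-within-part : ¬ Cycle (CI G D) → (c : Cycle (toGraph G)) →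
                        ∀ t → part (edges c t) ≡ part (edges c zero)
    cycle-within-part acyclic c t = begin
      part (edges c t)               ≡⟨ cong (part ∘ edges c) (pos-toℕ t) ⟨
      part (edges c (pos (toℕ t)))   ≡⟨ acyclic⇒closedWalk-constant Fin._≟_ sharedVertex acyclic (partWalk c)
                                          (ℕ.<⇒≤ (Fin.toℕ<n t)) ⟩
      part (edges c zero)            ∎
      where open ≡-Reasoning

    cycle-is-part : ¬ Cycle (CI G D) → ∀ {S} → IsCycleEdgeSet G S → ∃ λ i → cyc D i ≡ S
    cycle-is-part acyclic {S} (c , onc) = a , sym (cycleEdgeSet-⊆⇒≡ (c , onc) (isCycle D a) S⊆a)
      where
        a : Fin (k D)
        a = part (edges c zero)
        S⊆a : S ⊆ cyc D a
        S⊆a e∈S with t , refl ← proj₁ (onc _) e∈S =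
          subst (λ i → edges c t ∈ cyc D i) (cycle-within-part acyclic c t) (∈-part _)

parts-covered : ∀ {G} (D D′ : CycleDecomposition G) → (∀ j → ∃ λ i → cyc D i ≡ cyc D′ j) →
                ∀ i → ∃ λ j → cyc D′ j ≡ cyc D i
parts-covered D D′ D′⊆D i
  with C , onC ← isCycle D i
  with j , e∈D′j ← covers D′ (edges C zero)
  with i′ , D′j≡ ← D′⊆D j
  = j , trans (sym D′j≡) (cong (cyc D) (sym i≡i′))
  where
    i≡i′ : i ≡ i′
    i≡i′ = disjoint D _ i i′ (proj₂ (onC _) (zero , refl)) (subst (_ ∈_) (sym D′j≡) e∈D′j)

lemma1 : (G : FinGraph) → Connected (toGraph G) → Even G →
         (𝒞 : CycleDecomposition G) → IsTree (CI G 𝒞) →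
         HasUniqueCycleDecomposition G
lemma1 G _ _ 𝒞 (_ , acyclic) = 𝒞 , λ 𝒞′ → parts-covered 𝒞 𝒞′ (parts′ 𝒞′) , parts′ 𝒞′
  where
    parts′ : ∀ 𝒞′ j → ∃ λ i → cyc 𝒞 i ≡ cyc 𝒞′ j
    parts′ 𝒞′ j = cycle-is-part G 𝒞 acyclic (isCycle 𝒞′ j)
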